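{- Let $k\ge 0$ be an integer and $n=48k+46$; all arithmetic is modulo $n$. Define $c_1(r)=r$ for $0\le r\le n-1$. Define $c_2,c_3:\{0,\dots,n-1\}\to\mathbb{Z}_n$ by: for $0\le i\le 12k+11$, $c_2(2i)=6k+5+i(12k+12)$ and $c_3(2i)=6k+6+i(12k+13)$; for $0\le i\le 12k+10$, $c_2(2i+1)=12k+11+i(12k+12)$ and $c_3(2i+1)=24k+24+i(12k+13)$; and for $0\le r\le 24k+22$ and $\alpha=2,3$, $c_\alpha(n-1-r)=n-1-c_\alpha(r)$. For $\alpha=1,2,3$ let ${\cal L}_\alpha=[l_\alpha(r,j)]$ be the $n\times n$ array with $l_\alpha(r,j)\equiv c_\alpha(r)+j\pmod n$, $0\le r,j\le n-1$. Then ${\cal L}_1,{\cal L}_2,{\cal L}_3$ are three (cyclic) mutually nearly orthogonal Latin squares of order $n$, i.e. they are Latin squares and each pair of them is nearly orthogonal.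
   Context: A Latin square of order $n$ is an $n\times n$ array in which each row and each column contains each of the symbols $0,\dots,n-1$ exactly once. For Latin squares $L=[l(i,j)]$ and $M=[m(i,j)]$ of even order $n$ on symbols $\{0,\dots,n-1\}$, their superimposition is the $n\times n$ array $A=[(l(i,j),m(i,j))]$. $L$ and $M$ are nearly orthogonal if in $A$ every ordered pair $(x,y)$ with $0\le x,y\le n-1$, $x\ne y$, occurs at least once, and each ordered pair $(x,x+n/2)$ (second coordinate taken modulo $n$) occurs exactly twice. A set of Latin squares is mutually nearly orthogonal if every two of them are nearly orthogonal. -}

module Defs where

open import Data.Nat using (ℕ; zero; suc; _+_; _*_; _∸_; _<ᵇ_; _%_; _/_; NonZero)
open import Data.Nat.DivMod using (_mod_)
open import Data.Fin using (Fin; toℕ)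
open import Data.Fin.Properties using (_≟_)
open import Data.List using (List; map; allFin)
open import Data.Nat.ListAction using (sum)
open import Data.Bool using (Bool; true; false; if_then_else_)
open import Data.Product using (_×_; Σ; _,_)
open import Relation.Nullary using (¬_; ⌊_⌋)
open import Relation.Binary.PropositionalEquality using (_≡_)

Square : ℕ → Set
Square n = Fin n → Fin n → Fin n

Σfin : (n : ℕ) → (Fin n → ℕ) → ℕ
Σfin n f = sum (map f (allFin n))

[_≡ᶠ_] : ∀ {n} → Fin n → Fin n → ℕ
[ x ≡ᶠ y ] = if ⌊ x ≟ y ⌋ then 1 else 0

pairCount : ∀ {n} → Square n → Square n → Fin n → Fin n → ℕ
pairCount {n} L M x y =
  Σfin n (λ i → Σfin n (λ j → [ L i j ≡ᶠ x ] * [ M i j ≡ᶠ y ]))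

IsLatin : ∀ {n} → Square n → Set
IsLatin {n} L =
  (∀ (i s : Fin n) → Σfin n (λ j → [ L i j ≡ᶠ s ]) ≡ 1) ×
  (∀ (j s : Fin n) → Σfin n (λ i → [ L i j ≡ᶠ s ]) ≡ 1)

-- x + n/2 taken modulo n (n even, n = 2h, h = half).
shiftHalf : (h : ℕ) → .{{_ : NonZero (h + h)}} → Fin (h + h) → Fin (h + h)
shiftHalf h x = (toℕ x + h) mod (h + h)

NearlyOrthogonal : (h : ℕ) → .{{_ : NonZero (h + h)}} → Square (h + h) → Square (h + h) → Set
NearlyOrthogonal h L M =
  (∀ (x y : Fin (h + h)) → ¬ (x ≡ y) → 1 Data.Nat.≤ pairCount L M x y) ×
  (∀ (x : Fin (h + h)) → pairCount L M x (shiftHalf h x) ≡ 2)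

half : ℕ → ℕ
half k = 23 + 24 * k

ord : ℕ → ℕ
ord k = half k + half k

-- c on the first half 0 ≤ r ≤ 24k+22 (as natural numbers, before reduction):
-- r = 2i ↦ a + i·d,  r = 2i+1 ↦ b + i·d
cFirst : (a b d : ℕ) → ℕ → ℕ
cFirst a b d r = if ⌊ r % 2 Data.Nat.≟ 0 ⌋ then a + (r / 2) * d else b + (r / 2) * d

-- Extend to 0 ≤ r ≤ n-1 via c(n-1-r) = n-1-c(r) (mod n) for r ≤ 24k+22.
cExt : (k : ℕ) → (ℕ → ℕ) → Fin (ord k) → Fin (ord k)
cExt k f r with toℕ r <ᵇ half k
... | true  = f (toℕ r) mod ord k
... | false = ((ord k ∸ 1) ∸ toℕ (f ((ord k ∸ 1) ∸ toℕ r) mod ord k)) mod ord k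

c₁ c₂ c₃ : (k : ℕ) → Fin (ord k) → Fin (ord k)
c₁ k r = r
c₂ k = cExt k (cFirst (5 + 6 * k) (11 + 12 * k) (12 + 12 * k))
c₃ k = cExt k (cFirst (6 + 6 * k) (24 + 24 * k) (13 + 12 * k))

cyclicSquare : (k : ℕ) → (Fin (ord k) → Fin (ord k)) → Square (ord k)
cyclicSquare k c r j = (toℕ (c r) + toℕ j) mod ord k

𝓛₁ 𝓛₂ 𝓛₃ : (k : ℕ) → Square (ord k)
𝓛₁ k = cyclicSquare k (c₁ k)
𝓛₂ k = cyclicSquare k (c₂ k)
𝓛₃ k = cyclicSquare k (c₃ k)

module Submission where

-- The squares are cyclic, L_c(r, j) = c(r) + j, so in the superimposition of L_A and L_B
-- row r carries exactly the pairs (x, x + B(r) - A(r)).  Hence L_c is Latin as soon as c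
-- is onto, and the pair (x, y) occurs once for every row r with B(r) - A(r) = y - x.  If
-- the difference B - A hits every nonzero residue, it hits n/2 = -n/2 in two opposite rows,
-- and as there are only n rows, counting forces every nonzero difference to occur exactly
-- once except n/2, which occurs exactly twice.
--
-- All c_α commute with r ↦ n - 1 - r, so a difference at row n - 1 - r is the negative of
-- the one at row r, and it suffices to reach v or -v (for c itself: v or n - 1 - v) from
-- the first half of the rows.  There c_α and the differences are arithmetic progressions
-- (split into even and odd rows, and halved modulo n/2 where they have fixed parity) whose
-- step is invertible modulo n or n/2; inverting the step locates the row.

open import Defs
open import Data.Nat hiding (_≟_)
open import Data.Nat.Properties hiding (_≟_)
open import Data.Nat.DivMod
open import Data.Nat.Divisibility using (divides)
open import Data.Nat.ListAction using () renaming (sum to listSum)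
open import Data.Nat.Tactic.RingSolver using (solve-∀; solve)
open import Data.Bool using (true; false; T)
open import Data.Unit using (tt)
open import Data.Fin using (Fin; zero; suc; toℕ; fromℕ<; opposite)
open import Data.Fin.Properties using (_≟_; toℕ-injective; toℕ<n; toℕ-fromℕ<; opposite-prop; opposite-involutive)
  renaming (suc-injective to Fin-suc-injective)
open import Data.List using (tabulate; _∷_; [])
open import Data.List.Properties using (map-tabulate)
open import Data.Product using (∃-syntax; _×_; _,_; proj₁; proj₂)
open import Data.Sum using (_⊎_; inj₁; inj₂)
open import Function using (id; _∘_)
open import Relation.Nullary using (¬_; Dec; yes; no; contradiction)
open import Relation.Binary.Bundles using (Setoid)
open import Relation.Binary.Definitions using (Tri; tri<; tri≈; tri>)
open import Relation.Binary.PropositionalEquality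
import Relation.Binary.Reasoning.Setoid as SetoidReasoning
open import Algebra.Properties.CommutativeSemigroup +-commutativeSemigroup using (x∙yz≈y∙xz; xy∙z≈xz∙y)
open import Algebra.Properties.Semiring.Sum +-*-semiring
  using (sum; sum-syntax; ∑-comm; ∑-distrib-+; sum-cong-≗; *-distribʳ-sum)

module Congruence (N : ℕ) .{{_ : NonZero N}} where

  infix 4 _≈_
  record _≈_ (a b : ℕ) : Set where
    constructor mk≈
    field %-≡ : a % N ≡ b % N
  open _≈_ public

  ≈-refl : ∀ {a} → a ≈ a
  ≈-refl = mk≈ refl

  ≈-sym : ∀ {a b} → a ≈ b → b ≈ a
  ≈-sym (mk≈ p) = mk≈ (sym p)

  ≈-trans : ∀ {a b c} → a ≈ b → b ≈ c → a ≈ c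
  ≈-trans (mk≈ p) (mk≈ q) = mk≈ (trans p q)

  ≡⇒≈ : ∀ {a b} → a ≡ b → a ≈ b
  ≡⇒≈ refl = ≈-refl

  ≈-setoid : Setoid _ _
  ≈-setoid = record
    { Carrier = ℕ ; _≈_ = _≈_
    ; isEquivalence = record { refl = ≈-refl ; sym = ≈-sym ; trans = ≈-trans } }

  module ≈-Reasoning = SetoidReasoning ≈-setoid

  +-cong : ∀ {a b c d} → a ≈ b → c ≈ d → a + c ≈ b + d
  +-cong {a} {b} {c} {d} (mk≈ p) (mk≈ q) = mk≈ (begin
    (a + c) % N           ≡⟨ %-distribˡ-+ a c N ⟩
    (a % N + c % N) % N   ≡⟨ cong₂ (λ x y → (x + y) % N) p q ⟩
    (b % N + d % N) % N   ≡⟨ %-distribˡ-+ b d N ⟨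
    (b + d) % N           ∎)
    where open ≡-Reasoning

  *-cong : ∀ {a b c d} → a ≈ b → c ≈ d → a * c ≈ b * d
  *-cong {a} {b} {c} {d} (mk≈ p) (mk≈ q) = mk≈ (begin
    (a * c) % N             ≡⟨ %-distribˡ-* a c N ⟩
    (a % N * (c % N)) % N   ≡⟨ cong₂ (λ x y → (x * y) % N) p q ⟩
    (b % N * (d % N)) % N   ≡⟨ %-distribˡ-* b d N ⟨
    (b * d) % N             ∎)
    where open ≡-Reasoning

  +-congˡ : ∀ a {b c} → b ≈ c → a + b ≈ a + c
  +-congˡ a = +-cong (≈-refl {a})

  +-congʳ : ∀ {a b} c → a ≈ b → a + c ≈ b + c
  +-congʳ c p = +-cong p (≈-refl {c})

  m%N≈m : ∀ m → m % N ≈ m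
  m%N≈m m = mk≈ (m%n%n≡m%n m N)

  m+kN≈m : ∀ m k → m + k * N ≈ m
  m+kN≈m m k = mk≈ ([m+kn]%n≡m%n m k N)

  kN≈0 : ∀ k → k * N ≈ 0
  kN≈0 k = m+kN≈m 0 k

  N≈0 : N ≈ 0
  N≈0 = ≈-trans (≡⇒≈ (sym (+-identityʳ N))) (kN≈0 1)

  ≡+kN⇒≈ : ∀ {x y} q → x ≡ y + q * N → x ≈ y
  ≡+kN⇒≈ {y = y} q x≡y+qN = ≈-trans (≡⇒≈ x≡y+qN) (m+kN≈m y q)

  ≈⇒≡ : ∀ {a b} → a < N → b < N → a ≈ b → a ≡ b
  ≈⇒≡ a<N b<N (mk≈ p) = trans (sym (m<n⇒m%n≡m a<N)) (trans p (m<n⇒m%n≡m b<N))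

  neg : ℕ → ℕ
  neg c = N ∸ c % N

  +-inverseʳ : ∀ c → c + neg c ≈ 0
  +-inverseʳ c = begin
    c + neg c       ≈⟨ +-congʳ (neg c) (≈-sym (m%N≈m c)) ⟩
    c % N + neg c   ≡⟨ m+[n∸m]≡n (<⇒≤ (m%n<n c N)) ⟩
    N               ≡⟨ +-identityʳ N ⟨
    1 * N           ≈⟨ kN≈0 1 ⟩
    0               ∎
    where open ≈-Reasoning

  +-cancelʳ : ∀ {a b} c → a + c ≈ b + c → a ≈ b
  +-cancelʳ {a} {b} c p = begin
    a                  ≡⟨ +-identityʳ a ⟨
    a + 0              ≈⟨ +-congˡ a (≈-sym (+-inverseʳ c)) ⟩
    a + (c + neg c)    ≡⟨ +-assoc a c (neg c) ⟨
    a + c + neg c      ≈⟨ +-congʳ (neg c) p ⟩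
    b + c + neg c      ≡⟨ +-assoc b c (neg c) ⟩
    b + (c + neg c)    ≈⟨ +-congˡ b (+-inverseʳ c) ⟩
    b + 0              ≡⟨ +-identityʳ b ⟩
    b                  ∎
    where open ≈-Reasoning

  affine-surjective : ∀ {u d} → u * d ≈ 1 → ∀ a p → ∃[ t ] t < N × a + t * d ≈ p
  affine-surjective {u} {d} ud a p = t , m%n<n _ N , (begin
    a + t * d                     ≈⟨ +-congˡ a (*-cong (m%N≈m s) (≈-refl {d})) ⟩
    a + s * d                     ≡⟨ cong (a +_) (*-assoc (p + neg a) u d) ⟩
    a + (p + neg a) * (u * d)     ≈⟨ +-congˡ a (*-cong (≈-refl {p + neg a}) ud) ⟩
    a + (p + neg a) * 1           ≡⟨ cong (a +_) (*-identityʳ (p + neg a)) ⟩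
    a + (p + neg a)               ≡⟨ x∙yz≈y∙xz a p (neg a) ⟩
    p + (a + neg a)               ≈⟨ +-congˡ p (+-inverseʳ a) ⟩
    p + 0                         ≡⟨ +-identityʳ p ⟩
    p                             ∎)
    where
    open ≈-Reasoning
    s = (p + neg a) * u
    t = s % N

  affine-reflect : ∀ {a d p} t t′ → a + t * d ≈ p → p + (a + t′ * d) ≈ a + a + (t + t′) * d
  affine-reflect {a} {d} {p} t t′ e = begin
    p + (a + t′ * d)              ≈⟨ +-congʳ (a + t′ * d) (≈-sym e) ⟩
    a + t * d + (a + t′ * d)       ≡⟨ solve (a ∷ d ∷ t ∷ t′ ∷ []) ⟩
    a + a + (t + t′) * d           ∎
    where open ≈-Reasoning

double-≈ : ∀ h .{{_ : NonZero h}} .{{_ : NonZero (h + h)}} {x y} →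
           Congruence._≈_ h x y → Congruence._≈_ (h + h) (x + x) (y + y)
double-≈ h {x} {y} x≈y = begin
  x + x                             ≡⟨ halves x ⟩
  x % h + x % h + x / h * (h + h)   ≈⟨ m+kN≈m _ (x / h) ⟩
  x % h + x % h                     ≡⟨ cong (λ r → r + r) (Mod-h.%-≡ x≈y) ⟩
  y % h + y % h                     ≈⟨ m+kN≈m _ (y / h) ⟨
  y % h + y % h + y / h * (h + h)   ≡⟨ halves y ⟨
  y + y                             ∎
  where
  module Mod-h = Congruence h
  open Congruence (h + h)
  open ≈-Reasoning
  halves : ∀ m → m + m ≡ m % h + m % h + m / h * (h + h)
  halves m = trans (cong (λ z → z + z) (m≡m%n+[m/n]*n m h)) (regroup (m % h) (m / h) h)
    where
    regroup : ∀ r q h → r + q * h + (r + q * h) ≡ r + r + q * (h + h)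
    regroup = solve-∀

Σfin≡∑ : ∀ n (f : Fin n → ℕ) → Σfin n f ≡ ∑[ i < n ] f i
Σfin≡∑ n f = trans (cong listSum (map-tabulate id f)) (listSum-tabulate f)
  where
  listSum-tabulate : ∀ {n} (f : Fin n → ℕ) → listSum (tabulate f) ≡ sum f
  listSum-tabulate {zero} f = refl
  listSum-tabulate {suc n} f = cong (f zero +_) (listSum-tabulate (f ∘ suc))

∑-ones : ∀ n → ∑[ i < n ] 1 ≡ n
∑-ones zero = refl
∑-ones (suc n) = cong suc (∑-ones n)

∑-mono-≤ : ∀ {n} {f g : Fin n → ℕ} → (∀ i → f i ≤ g i) → sum f ≤ sum g
∑-mono-≤ {zero} f≤g = z≤n
∑-mono-≤ {suc n} f≤g = +-mono-≤ (f≤g zero) (∑-mono-≤ (f≤g ∘ suc))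

∑-tight : ∀ {n} {f g : Fin n → ℕ} → (∀ i → f i ≤ g i) → sum f ≡ sum g → ∀ i → f i ≡ g i
∑-tight {suc n} {f} {g} f≤g ∑≡ = λ where
    zero → head≡
    (suc i) → ∑-tight (f≤g ∘ suc) (+-cancelˡ-≡ (f zero) _ _ (trans ∑≡ (cong (_+ sum (g ∘ suc)) (sym head≡)))) i
  where
  head≡ : f zero ≡ g zero
  head≡ = ≤-antisym (f≤g zero) (+-cancelʳ-≤ (sum (f ∘ suc)) (g zero) (f zero)
    (≤-trans (+-monoʳ-≤ (g zero) (∑-mono-≤ (f≤g ∘ suc))) (≤-reflexive (sym ∑≡))))

term≤∑ : ∀ {n} (f : Fin n → ℕ) i → f i ≤ sum f
term≤∑ f zero = m≤m+n _ _
term≤∑ f (suc i) = ≤-trans (term≤∑ (f ∘ suc) i) (m≤n+m _ _)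

two-terms≤∑ : ∀ {n} (f : Fin n → ℕ) {i j} → ¬ i ≡ j → f i + f j ≤ sum f
two-terms≤∑ f {zero} {zero} i≢j = contradiction refl i≢j
two-terms≤∑ f {zero} {suc j} i≢j = +-monoʳ-≤ (f zero) (term≤∑ (f ∘ suc) j)
two-terms≤∑ f {suc i} {zero} i≢j =
  ≤-trans (≤-reflexive (+-comm (f (suc i)) (f zero))) (+-monoʳ-≤ (f zero) (term≤∑ (f ∘ suc) i))
two-terms≤∑ f {suc i} {suc j} i≢j =
  ≤-trans (two-terms≤∑ (f ∘ suc) (i≢j ∘ cong suc)) (m≤n+m _ _)

[≡ᶠ]-true : ∀ {n} {x y : Fin n} → x ≡ y → [ x ≡ᶠ y ] ≡ 1
[≡ᶠ]-true {x = x} {y} x≡y with x ≟ y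
... | yes _ = refl
... | no x≢y = contradiction x≡y x≢y

[≡ᶠ]-false : ∀ {n} {x y : Fin n} → ¬ x ≡ y → [ x ≡ᶠ y ] ≡ 0
[≡ᶠ]-false {x = x} {y} x≢y with x ≟ y
... | yes x≡y = contradiction x≡y x≢y
... | no _ = refl

[≡ᶠ]-cong : ∀ {m n} {x y : Fin m} {z w : Fin n} → (x ≡ y → z ≡ w) → (z ≡ w → x ≡ y) →
            [ x ≡ᶠ y ] ≡ [ z ≡ᶠ w ]
[≡ᶠ]-cong {x = x} {y} to from with x ≟ y
... | yes x≡y = sym ([≡ᶠ]-true (to x≡y))
... | no x≢y = sym ([≡ᶠ]-false (x≢y ∘ from))

∑-[≡ᶠ] : ∀ {n} (a : Fin n) → ∑[ v < n ] [ a ≡ᶠ v ] ≡ 1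
∑-[≡ᶠ] {suc n} zero = cong suc (∑-zeros n)
  where
  ∑-zeros : ∀ n → ∑[ i < n ] 0 ≡ 0
  ∑-zeros zero = refl
  ∑-zeros (suc n) = ∑-zeros n
∑-[≡ᶠ] {suc n} (suc a) =
  trans (sum-cong-≗ {n} (λ v → [≡ᶠ]-cong Fin-suc-injective (cong suc))) (∑-[≡ᶠ] a)

count : ∀ {n} → (Fin n → Fin n) → Fin n → ℕ
count {n} F v = ∑[ r < n ] [ F r ≡ᶠ v ]

∑-count : ∀ {n} (F : Fin n → Fin n) → ∑[ v < n ] count F v ≡ n
∑-count {n} F = begin
  ∑[ v < n ] ∑[ r < n ] [ F r ≡ᶠ v ]   ≡⟨ ∑-comm (λ v r → [ F r ≡ᶠ v ]) ⟩
  ∑[ r < n ] ∑[ v < n ] [ F r ≡ᶠ v ]   ≡⟨ sum-cong-≗ (∑-[≡ᶠ] ∘ F) ⟩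
  ∑[ r < n ] 1                          ≡⟨ ∑-ones n ⟩
  n                                     ∎
  where open ≡-Reasoning

count-exact : ∀ {n} (F : Fin n → Fin n) (lower : Fin n → ℕ) →
              (∀ v → lower v ≤ count F v) → ∑[ v < n ] lower v ≡ n → ∀ v → count F v ≡ lower v
count-exact F lower lower≤ ∑lower = sym ∘ ∑-tight lower≤ (trans ∑lower (sym (∑-count F)))

count≥1 : ∀ {n} (F : Fin n → Fin n) {v} r → F r ≡ v → 1 ≤ count F v
count≥1 F {v} r Fr≡v = subst (_≤ count F v) ([≡ᶠ]-true Fr≡v) (term≤∑ _ r)

count≥2 : ∀ {n} (F : Fin n → Fin n) {v r₁ r₂} → ¬ r₁ ≡ r₂ → F r₁ ≡ v → F r₂ ≡ v → 2 ≤ count F v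
count≥2 F {v} r₁≢r₂ e₁ e₂ = subst (_≤ count F v) (cong₂ _+_ ([≡ᶠ]-true e₁) ([≡ᶠ]-true e₂)) (two-terms≤∑ _ r₁≢r₂)

surjective⇒count≡1 : ∀ {n} (F : Fin n → Fin n) → (∀ v → ∃[ r ] F r ≡ v) → ∀ v → count F v ≡ 1
surjective⇒count≡1 {n} F surj =
  count-exact F (λ _ → 1) (λ v → count≥1 F (proj₁ (surj v)) (proj₂ (surj v))) (∑-ones n)

module CyclicSquare (n : ℕ) .{{_ : NonZero n}} where

  open Congruence n

  cyclic : (Fin n → Fin n) → Square n
  cyclic c r j = (toℕ (c r) + toℕ j) mod n

  CommutesWithOpposite : (Fin n → Fin n) → Set
  CommutesWithOpposite c = ∀ r → c (opposite r) ≡ opposite (c r)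

  -- c r = v, or c r = n - 1 - v, stated without subtraction
  Reaches : (Fin n → Fin n) → ℕ → Set
  Reaches c v = ∃[ r ] (toℕ (c r) ≈ v ⊎ 1 + v + toℕ (c r) ≈ 0)

  Covers : (A B : Fin n → Fin n) → ℕ → Set
  Covers A B v = ∃[ r ] (v + toℕ (A r) ≈ toℕ (B r) ⊎ v + toℕ (B r) ≈ toℕ (A r))

  toℕ-mod : ∀ m → toℕ (m mod n) ≡ m % n
  toℕ-mod m = toℕ-fromℕ< (m%n<n m n)

  toℕ-mod≈ : ∀ m → toℕ (m mod n) ≈ m
  toℕ-mod≈ m = ≈-trans (≡⇒≈ (toℕ-mod m)) (m%N≈m m)

  ≈⇒mod≡ : ∀ {m} s → m ≈ toℕ s → m mod n ≡ s
  ≈⇒mod≡ s m≈s = toℕ-injective (≈⇒≡ (toℕ<n _) (toℕ<n s) (≈-trans (toℕ-mod≈ _) m≈s))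

  mod≡⇒≈ : ∀ {m} s → m mod n ≡ s → m ≈ toℕ s
  mod≡⇒≈ s refl = ≈-sym (toℕ-mod≈ _)

  ≈⇒Fin≡ : ∀ {x y : Fin n} → toℕ x ≈ toℕ y → x ≡ y
  ≈⇒Fin≡ = toℕ-injective ∘ ≈⇒≡ (toℕ<n _) (toℕ<n _)

  infixl 6 _⊖_
  _⊖_ : Fin n → Fin n → Fin n
  y ⊖ x = (toℕ y + neg (toℕ x)) mod n

  x+[y⊖x]≈y : ∀ x y → toℕ x + toℕ (y ⊖ x) ≈ toℕ y
  x+[y⊖x]≈y x y = begin
    toℕ x + toℕ (y ⊖ x)             ≈⟨ +-congˡ (toℕ x) (toℕ-mod≈ _) ⟩
    toℕ x + (toℕ y + neg (toℕ x))   ≡⟨ x∙yz≈y∙xz (toℕ x) (toℕ y) _ ⟩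
    toℕ y + (toℕ x + neg (toℕ x))   ≈⟨ +-congˡ (toℕ y) (+-inverseʳ (toℕ x)) ⟩
    toℕ y + 0                       ≡⟨ +-identityʳ (toℕ y) ⟩
    toℕ y                           ∎
    where open ≈-Reasoning

  ⊖-unique : ∀ {x y v} → v < n → v + toℕ x ≈ toℕ y → toℕ (y ⊖ x) ≡ v
  ⊖-unique {x} {y} {v} v<n v+x≈y = ≈⇒≡ (toℕ<n _) v<n (+-cancelʳ (toℕ x) (begin
    toℕ (y ⊖ x) + toℕ x   ≡⟨ +-comm _ (toℕ x) ⟩
    toℕ x + toℕ (y ⊖ x)   ≈⟨ x+[y⊖x]≈y x y ⟩
    toℕ y                 ≈⟨ v+x≈y ⟨
    v + toℕ x             ∎))
    where open ≈-Reasoning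

  ⊖-spec : ∀ {x y v} → toℕ (y ⊖ x) ≡ v → v + toℕ x ≈ toℕ y
  ⊖-spec {x} {y} refl = ≈-trans (≡⇒≈ (+-comm _ (toℕ x))) (x+[y⊖x]≈y x y)

  opposite+suc : ∀ x → toℕ (opposite x) + suc (toℕ x) ≡ n
  opposite+suc x = trans (cong (_+ suc (toℕ x)) (opposite-prop x)) (m∸n+n≡m (toℕ<n x))

  opposite-swap : ∀ {x y v} → v + toℕ y ≈ toℕ x → v + toℕ (opposite x) ≈ toℕ (opposite y)
  opposite-swap {x} {y} {v} v+y≈x = +-cancelʳ (suc (toℕ x)) (begin
    v + toℕ (opposite x) + suc (toℕ x)       ≡⟨ +-assoc v _ _ ⟩
    v + (toℕ (opposite x) + suc (toℕ x))     ≡⟨ cong (v +_) (opposite+suc x) ⟩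
    v + n                                    ≡⟨ cong (v +_) (opposite+suc y) ⟨
    v + (toℕ (opposite y) + suc (toℕ y))     ≡⟨ x∙yz≈y∙xz v (toℕ (opposite y)) (suc (toℕ y)) ⟩
    toℕ (opposite y) + (v + suc (toℕ y))     ≡⟨ cong (toℕ (opposite y) +_) (+-suc v (toℕ y)) ⟩
    toℕ (opposite y) + suc (v + toℕ y)       ≈⟨ +-congˡ (toℕ (opposite y)) (+-congˡ 1 v+y≈x) ⟩
    toℕ (opposite y) + suc (toℕ x)           ∎)
    where open ≈-Reasoning

  opposite-≈ : ∀ {x v} → 1 + v + toℕ x ≈ 0 → toℕ (opposite x) ≈ v
  opposite-≈ {x} {v} 1+v+x≈0 = begin
    toℕ (opposite x)                        ≡⟨ +-identityʳ _ ⟨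
    toℕ (opposite x) + 0                    ≈⟨ +-congˡ (toℕ (opposite x)) 1+v+x≈0 ⟨
    toℕ (opposite x) + (1 + v + toℕ x)      ≡⟨ cong (toℕ (opposite x) +_) (+-comm (suc v) (toℕ x)) ⟩
    toℕ (opposite x) + (toℕ x + suc v)      ≡⟨ cong (toℕ (opposite x) +_) (+-suc (toℕ x) v) ⟩
    toℕ (opposite x) + (suc (toℕ x) + v)    ≡⟨ +-assoc (toℕ (opposite x)) _ v ⟨
    toℕ (opposite x) + suc (toℕ x) + v      ≡⟨ cong (_+ v) (opposite+suc x) ⟩
    n + v                                   ≈⟨ +-congʳ v N≈0 ⟩
    v                                       ∎
    where open ≈-Reasoning

  row-count : ∀ c r s → count (cyclic c r) s ≡ 1
  row-count c r s = surjective⇒count≡1 (cyclic c r) (λ s → s ⊖ c r , ≈⇒mod≡ s (x+[y⊖x]≈y (c r) s)) s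

  isLatin-cyclic : ∀ c → (∀ s → ∃[ r ] c r ≡ s) → IsLatin (cyclic c)
  isLatin-cyclic c surj =
    (λ r s → trans (Σfin≡∑ n _) (row-count c r s)) ,
    (λ j s → trans (Σfin≡∑ n _) (surjective⇒count≡1 (λ r → cyclic c r j) (column-hit j) s))
    where
    column-hit : ∀ j s → ∃[ r ] cyclic c r j ≡ s
    column-hit j s with surj (s ⊖ j)
    ... | r , cr≡s⊖j = r , ≈⇒mod≡ s (begin
      toℕ (c r) + toℕ j         ≡⟨ +-comm _ (toℕ j) ⟩
      toℕ j + toℕ (c r)         ≡⟨ cong (λ z → toℕ j + toℕ z) cr≡s⊖j ⟩
      toℕ j + toℕ (s ⊖ j)       ≈⟨ x+[y⊖x]≈y j s ⟩
      toℕ s                     ∎)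
      where open ≈-Reasoning

  reaches⇒surjective : ∀ c → CommutesWithOpposite c → (∀ v → v < n → Reaches c v) → ∀ s → ∃[ r ] c r ≡ s
  reaches⇒surjective c comm reach s with reach (toℕ s) (toℕ<n s)
  ... | r , inj₁ cr≈s = r , ≈⇒Fin≡ cr≈s
  ... | r , inj₂ 1+s+cr≈0 = opposite r , trans (comm r) (≈⇒Fin≡ (opposite-≈ 1+s+cr≈0))

  ⊖-hit-opposite : ∀ {A B} → CommutesWithOpposite A → CommutesWithOpposite B →
                   ∀ {v r} → v < n → v + toℕ (B r) ≈ toℕ (A r) → toℕ (B (opposite r) ⊖ A (opposite r)) ≡ v
  ⊖-hit-opposite {A} {B} commA commB {v} {r} v<n v+Br≈Ar = ⊖-unique v<n
    (subst₂ (λ a b → v + toℕ a ≈ toℕ b) (sym (commA r)) (sym (commB r)) (opposite-swap v+Br≈Ar))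

  covers⇒hit : ∀ {A B} → CommutesWithOpposite A → CommutesWithOpposite B →
               ∀ {v} → v < n → Covers A B v → ∃[ r ] toℕ (B r ⊖ A r) ≡ v
  covers⇒hit commA commB v<n (r , inj₁ v+Ar≈Br) = r , ⊖-unique v<n v+Ar≈Br
  covers⇒hit commA commB v<n (r , inj₂ v+Br≈Ar) = opposite r , ⊖-hit-opposite commA commB v<n v+Br≈Ar

  pairCount-cyclic : ∀ A B x y → pairCount (cyclic A) (cyclic B) x y ≡ count (λ r → B r ⊖ A r) (y ⊖ x)
  pairCount-cyclic A B x y = trans (Σfin≡∑ n _) (sum-cong-≗ row-term)
    where
    δ : Fin n → ℕ
    δ r = [ B r ⊖ A r ≡ᶠ y ⊖ x ]

    cell : ∀ r j → [ cyclic A r j ≡ᶠ x ] * [ cyclic B r j ≡ᶠ y ] ≡ [ cyclic A r j ≡ᶠ x ] * δ r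
    cell r j with cyclic A r j ≟ x
    ... | no _ = refl
    ... | yes Arj≡x = cong (1 *_) ([≡ᶠ]-cong to from)
      where
      open ≈-Reasoning
      a = toℕ (A r)
      b = toℕ (B r)
      i = toℕ j
      t = toℕ (y ⊖ x)
      a+i≈x : a + i ≈ toℕ x
      a+i≈x = mod≡⇒≈ x Arj≡x
      a+t+i≈y : a + t + i ≈ toℕ y
      a+t+i≈y = begin
        a + t + i     ≡⟨ xy∙z≈xz∙y a t i ⟩
        a + i + t     ≈⟨ +-congʳ t a+i≈x ⟩
        toℕ x + t     ≈⟨ x+[y⊖x]≈y x y ⟩
        toℕ y         ∎
      to : cyclic B r j ≡ y → B r ⊖ A r ≡ y ⊖ x
      to Brj≡y = toℕ-injective (⊖-unique (toℕ<n _) (+-cancelʳ i (begin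
        t + a + i     ≡⟨ cong (_+ i) (+-comm t a) ⟩
        a + t + i     ≈⟨ a+t+i≈y ⟩
        toℕ y         ≈⟨ mod≡⇒≈ y Brj≡y ⟨
        b + i         ∎)))
      from : B r ⊖ A r ≡ y ⊖ x → cyclic B r j ≡ y
      from D≡ = ≈⇒mod≡ y (begin
        b + i                       ≈⟨ +-congʳ i (x+[y⊖x]≈y (A r) (B r)) ⟨
        a + toℕ (B r ⊖ A r) + i     ≡⟨ cong (λ z → a + toℕ z + i) D≡ ⟩
        a + t + i                   ≈⟨ a+t+i≈y ⟩
        toℕ y                       ∎)

    row-term : ∀ r → Σfin n (λ j → [ cyclic A r j ≡ᶠ x ] * [ cyclic B r j ≡ᶠ y ]) ≡ δ r
    row-term r = begin
      Σfin n (λ j → [ cyclic A r j ≡ᶠ x ] * [ cyclic B r j ≡ᶠ y ])   ≡⟨ Σfin≡∑ n _ ⟩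
      ∑[ j < n ] ([ cyclic A r j ≡ᶠ x ] * [ cyclic B r j ≡ᶠ y ])     ≡⟨ sum-cong-≗ (cell r) ⟩
      ∑[ j < n ] ([ cyclic A r j ≡ᶠ x ] * δ r)                       ≡⟨ *-distribʳ-sum (δ r) (λ j → [ cyclic A r j ≡ᶠ x ]) ⟨
      count (cyclic A r) x * δ r                                     ≡⟨ cong (_* δ r) (row-count A r x) ⟩
      1 * δ r                                                        ≡⟨ *-identityˡ (δ r) ⟩
      δ r                                                            ∎
      where open ≡-Reasoning

even-or-odd : ∀ v → ∃[ q ] (v ≡ q + q ⊎ v ≡ suc (q + q))
even-or-odd zero = 0 , inj₁ refl
even-or-odd (suc zero) = 0 , inj₂ refl
even-or-odd (suc (suc v)) with even-or-odd v
... | q , inj₁ refl = suc q , inj₁ (cong suc (sym (+-suc q q)))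
... | q , inj₂ refl = suc q , inj₂ (cong (λ z → suc (suc z)) (sym (+-suc q q)))

split-< : ∀ {s t m} → s ≤ t → t < s + m → ∃[ i ] i < m × s + i ≡ t
split-< {s} {t} {m} s≤t t<s+m =
  t ∸ s , +-cancelˡ-< s (t ∸ s) m (subst (_< s + m) (sym (m+[n∸m]≡n s≤t)) t<s+m) , m+[n∸m]≡n s≤t

complement-< : ∀ {a b c d} → c < a → a + b ≡ c + d → b < d
complement-< {a} {b} {c} {d} c<a a+b≡c+d = +-cancelˡ-< c b d (subst (c + b <_) a+b≡c+d (+-monoˡ-< b c<a))

half-pos : ∀ {q} → 0 < q + q → 0 < q
half-pos {suc q} _ = z<s

half-< : ∀ {q m} → q + q < m + m → q < m
half-< q+q<m+m = ≰⇒> (λ m≤q → <⇒≱ q+q<m+m (+-mono-≤ m≤q m≤q))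

nonzero : ∀ {n} → Fin n → ℕ
nonzero zero = 0
nonzero (suc _) = 1

nonzero≤ : ∀ {n c} (v : Fin n) → (0 < toℕ v → 1 ≤ c) → nonzero v ≤ c
nonzero≤ zero _ = z≤n
nonzero≤ (suc v) 1≤c = 1≤c z<s

nonzero-pos : ∀ {n} (v : Fin n) → 0 < toℕ v → nonzero v ≡ 1
nonzero-pos (suc v) _ = refl

∑-nonzero : ∀ n → ∑[ v < n ] nonzero v ≡ n ∸ 1
∑-nonzero zero = refl
∑-nonzero (suc n) = ∑-ones n

odd≢even : ∀ m k → suc (m + m) ≢ k + k
odd≢even m zero ()
odd≢even zero (suc k) e = 0≢1+n (trans (suc-injective e) (+-suc k k))
odd≢even (suc m) (suc k) e =
  odd≢even m k (suc-injective (suc-injective (trans (cong suc (sym (+-suc (suc m) m))) (trans e (+-suc (suc k) k)))))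

module NearOrthogonality (h : ℕ) .{{_ : NonZero (h + h)}} where

  open Congruence (h + h)
  open CyclicSquare (h + h)

  0<h : 0 < h
  0<h = half-pos (>-nonZero⁻¹ (h + h))

  h<n : h < h + h
  h<n = m<m+n h 0<h

  ≢-opposite : ∀ r → r ≢ opposite r
  ≢-opposite r r≡opp = odd≢even (toℕ r) h (begin
    suc (toℕ r + toℕ r)              ≡⟨ +-suc (toℕ r) (toℕ r) ⟨
    toℕ r + suc (toℕ r)              ≡⟨ cong (λ z → toℕ z + suc (toℕ r)) r≡opp ⟩
    toℕ (opposite r) + suc (toℕ r)   ≡⟨ opposite+suc r ⟩
    h + h                            ∎)
    where open ≡-Reasoning

  half-self-negative : ∀ {a b} → h + a ≈ b → h + b ≈ a
  half-self-negative {a} {b} h+a≈b = begin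
    h + b          ≈⟨ +-congˡ h h+a≈b ⟨
    h + (h + a)    ≡⟨ +-assoc h h a ⟨
    h + h + a      ≈⟨ +-congʳ a N≈0 ⟩
    a              ∎
    where open ≈-Reasoning

  nearlyOrthogonal-cyclic : ∀ A B → CommutesWithOpposite A → CommutesWithOpposite B →
                            (∀ v → 0 < v → v < h + h → Covers A B v) →
                            NearlyOrthogonal h (cyclic A) (cyclic B)
  nearlyOrthogonal-cyclic A B commA commB covers = at-least-once , twice-at-half
    where
    D : Fin (h + h) → Fin (h + h)
    D r = B r ⊖ A r

    hit : ∀ v → 0 < v → v < h + h → ∃[ r ] toℕ (D r) ≡ v
    hit v 0<v v<n = covers⇒hit commA commB v<n (covers v 0<v v<n)

    count≥1-at-nonzero : ∀ w → 0 < toℕ w → 1 ≤ count D w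
    count≥1-at-nonzero w 0<w with hit (toℕ w) 0<w (toℕ<n w)
    ... | r , e = count≥1 D r (toℕ-injective e)

    at-least-once : ∀ x y → x ≢ y → 1 ≤ pairCount (cyclic A) (cyclic B) x y
    at-least-once x y x≢y = subst (1 ≤_) (sym (pairCount-cyclic A B x y))
      (count≥1-at-nonzero (y ⊖ x) (n≢0⇒n>0 (λ y⊖x≡0 → x≢y (≈⇒Fin≡ (⊖-spec y⊖x≡0)))))

    -- The row r with D r = h and its opposite both hit h; with this, the lower bound
    -- below sums to n, so every bound is attained.
    twice-at-half : ∀ x → pairCount (cyclic A) (cyclic B) x (shiftHalf h x) ≡ 2
    twice-at-half x = begin
      pairCount (cyclic A) (cyclic B) x (shiftHalf h x)   ≡⟨ pairCount-cyclic A B x (shiftHalf h x) ⟩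
      count D δ                                           ≡⟨ count-exact D lower lower≤count ∑lower δ ⟩
      nonzero δ + [ δ ≡ᶠ δ ]                              ≡⟨ cong₂ _+_ (nonzero-pos δ (subst (0 <_) (sym δ≡h) 0<h)) ([≡ᶠ]-true refl) ⟩
      2                                                   ∎
      where
      open ≡-Reasoning
      δ = shiftHalf h x ⊖ x
      δ≡h : toℕ δ ≡ h
      δ≡h = ⊖-unique h<n (≈-trans (≡⇒≈ (+-comm h (toℕ x))) (≈-sym (toℕ-mod≈ _)))

      r = proj₁ (hit h 0<h h<n)
      Dr≡h : toℕ (D r) ≡ h
      Dr≡h = proj₂ (hit h 0<h h<n)
      Dr≡δ : D r ≡ δ
      Dr≡δ = toℕ-injective (trans Dr≡h (sym δ≡h))
      D-opposite≡δ : D (opposite r) ≡ δ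
      D-opposite≡δ = toℕ-injective (trans (⊖-hit-opposite commA commB h<n (half-self-negative (⊖-spec Dr≡h))) (sym δ≡h))

      lower : Fin (h + h) → ℕ
      lower v = nonzero v + [ δ ≡ᶠ v ]

      ∑lower : ∑[ v < h + h ] lower v ≡ h + h
      ∑lower = trans (∑-distrib-+ nonzero ([_≡ᶠ_] δ)) (trans (cong₂ _+_ (∑-nonzero (h + h)) (∑-[≡ᶠ] δ))
        (m∸n+n≡m (>-nonZero⁻¹ (h + h))))

      lower≤count : ∀ v → lower v ≤ count D v
      lower≤count v with δ ≟ v
      ... | yes δ≡v = ≤-trans (+-monoˡ-≤ 1 (nonzero≤ v (λ _ → ≤-refl)))
                              (count≥2 D (≢-opposite r) (trans Dr≡δ δ≡v) (trans D-opposite≡δ δ≡v))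
      ... | no _ = subst (_≤ count D v) (sym (+-identityʳ (nonzero v))) (nonzero≤ v (count≥1-at-nonzero v))

cFirst-even : ∀ a b d i → cFirst a b d (i * 2) ≡ a + i * d
cFirst-even a b d i rewrite m*n%n≡0 i 2 ⦃ nonZero ⦄ | m*n/n≡m i 2 ⦃ nonZero ⦄ = refl

cFirst-odd : ∀ a b d i → cFirst a b d (1 + i * 2) ≡ b + i * d
cFirst-odd a b d i rewrite [m+kn]%n≡m%n 1 i 2 ⦃ nonZero ⦄
                         | +-distrib-/-∣ʳ 1 {i * 2} {2} ⦃ nonZero ⦄ (divides i refl)
                         | m*n/n≡m i 2 ⦃ nonZero ⦄ = refl

module Construction (k : ℕ) where

  n : ℕ
  n = ord k

  h : ℕ
  h = half k

  -- the moduli are spelled out so that the ring solver sees polynomials in k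
  open Congruence ((23 + 24 * k) + (23 + 24 * k))
  module Mod-h = Congruence (23 + 24 * k)
  open CyclicSquare n

  h<n : h < n
  h<n = m<m+n h z<s

  opposite<h : ∀ {r} → ¬ toℕ r < h → toℕ (opposite r) < h
  opposite<h {r} r≮h = +-cancelʳ-< (suc (toℕ r)) (toℕ (opposite r)) h
    (subst (_< h + suc (toℕ r)) (sym (opposite+suc r)) (+-monoʳ-< h (s≤s (≮⇒≥ r≮h))))

  opposite≮h : ∀ {r} → toℕ r < h → ¬ toℕ (opposite r) < h
  opposite≮h {r} r<h opp<h = <-irrefl (opposite+suc r) (+-mono-<-≤ opp<h r<h)

  cExt-first : ∀ f r → toℕ r < h → toℕ (cExt k f r) ≡ f (toℕ r) % n
  cExt-first f r r<h with toℕ r <ᵇ h in eq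
  ... | true = toℕ-mod (f (toℕ r))
  ... | false = contradiction (subst T eq (<⇒<ᵇ r<h)) λ ()

  cExt-second : ∀ f r → ¬ toℕ r < h → cExt k f r ≡ opposite (cExt k f (opposite r))
  cExt-second f r r≮h with toℕ r <ᵇ h in eq
  ... | true = contradiction (<ᵇ⇒< _ _ (subst T (sym eq) tt)) r≮h
  ... | false = toℕ-injective (begin
    toℕ ((n ∸ 1 ∸ toℕ (f (n ∸ 1 ∸ toℕ r) mod n)) mod n)   ≡⟨ toℕ-mod (n ∸ 1 ∸ toℕ (f (n ∸ 1 ∸ toℕ r) mod n)) ⟩
    (n ∸ 1 ∸ toℕ (f (n ∸ 1 ∸ toℕ r) mod n)) % n          ≡⟨ m<n⇒m%n≡m (s≤s (m∸n≤m (n ∸ 1) (toℕ (f (n ∸ 1 ∸ toℕ r) mod n)))) ⟩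
    n ∸ 1 ∸ toℕ (f (n ∸ 1 ∸ toℕ r) mod n)                ≡⟨ cong (λ z → n ∸ 1 ∸ toℕ (f z mod n)) (opposite-prop r) ⟨
    n ∸ 1 ∸ toℕ (f (toℕ (opposite r)) mod n)             ≡⟨ cong (n ∸ 1 ∸_) (toℕ-mod (f (toℕ (opposite r)))) ⟩
    n ∸ 1 ∸ f (toℕ (opposite r)) % n                     ≡⟨ cong (n ∸ 1 ∸_) (cExt-first f (opposite r) (opposite<h r≮h)) ⟨
    n ∸ 1 ∸ toℕ (cExt k f (opposite r))                  ≡⟨ opposite-prop (cExt k f (opposite r)) ⟨
    toℕ (opposite (cExt k f (opposite r)))               ∎)
    where open ≡-Reasoning

  cExt-commutes : ∀ f → CommutesWithOpposite (cExt k f)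
  cExt-commutes f r with toℕ r <? h
  ... | yes r<h = trans (cExt-second f (opposite r) (opposite≮h r<h)) (cong (opposite ∘ cExt k f) (opposite-involutive r))
  ... | no r≮h = trans (sym (opposite-involutive _)) (cong opposite (sym (cExt-second f r r≮h)))

  row : ∀ r₀ → r₀ < h → Fin n
  row r₀ r₀<h = fromℕ< (<-trans r₀<h h<n)

  toℕ-row : ∀ {r₀} (r₀<h : r₀ < h) → toℕ (row r₀ r₀<h) ≡ r₀
  toℕ-row r₀<h = toℕ-fromℕ< _

  cExt-row : ∀ f {r₀} (r₀<h : r₀ < h) → toℕ (cExt k f (row r₀ r₀<h)) ≈ f r₀
  cExt-row f {r₀} r₀<h = ≈-trans (≡⇒≈ (trans (cExt-first f (row r₀ r₀<h) (subst (_< h) (sym (toℕ-row r₀<h)) r₀<h))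
    (cong (λ z → f z % n) (toℕ-row r₀<h)))) (m%N≈m (f r₀))

  c₁-commutes : CommutesWithOpposite (c₁ k)
  c₁-commutes r = refl

  even-row<h : ∀ {i} → i < 12 + 12 * k → i * 2 < h
  even-row<h {i} i< = s≤s (begin
    i * 2               ≤⟨ *-monoˡ-≤ 2 (s≤s⁻¹ i<) ⟩
    (11 + 12 * k) * 2   ≡⟨ solve (k ∷ []) ⟩
    22 + 24 * k         ∎)
    where open ≤-Reasoning

  odd-row<h : ∀ {i} → i < 11 + 12 * k → 1 + i * 2 < h
  odd-row<h {i} i< = s≤s (begin
    suc (i * 2)              ≤⟨ s≤s (*-monoˡ-≤ 2 (s≤s⁻¹ i<)) ⟩
    suc ((10 + 12 * k) * 2)  ≡⟨ solve (k ∷ []) ⟩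
    21 + 24 * k              ≤⟨ n≤1+n _ ⟩
    22 + 24 * k              ∎)
    where open ≤-Reasoning

  covers-row : ∀ {A B a b v r₀} (r₀<h : r₀ < h) →
               toℕ (A (row r₀ r₀<h)) ≈ a → toℕ (B (row r₀ r₀<h)) ≈ b →
               v + a ≈ b ⊎ v + b ≈ a → Covers A B v
  covers-row {v = v} r₀<h A≈a B≈b (inj₁ v+a≈b) =
    row _ r₀<h , inj₁ (≈-trans (+-congˡ v A≈a) (≈-trans v+a≈b (≈-sym B≈b)))
  covers-row {v = v} r₀<h A≈a B≈b (inj₂ v+b≈a) =
    row _ r₀<h , inj₂ (≈-trans (+-congˡ v B≈b) (≈-trans v+b≈a (≈-sym A≈a)))

  progression-row : ∀ a b d → b ≈ a + (12 + 12 * k) * d →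
                    ∀ t → t < h → ∃[ r₀ ] r₀ < h × cFirst a b d r₀ ≈ a + t * d
  progression-row a b d b≈ t t<h = row-of (t <? 12 + 12 * k)
    where
    halves : 23 + 24 * k ≡ (12 + 12 * k) + (11 + 12 * k)
    halves = solve (k ∷ [])
    odd-row-of : ∃[ i ] i < 11 + 12 * k × (12 + 12 * k) + i ≡ t → ∃[ r₀ ] r₀ < h × cFirst a b d r₀ ≈ a + t * d
    odd-row-of (i , i< , refl) = 1 + i * 2 , odd-row<h i< , (begin
      cFirst a b d (1 + i * 2)          ≡⟨ cFirst-odd a b d i ⟩
      b + i * d                         ≈⟨ +-congʳ (i * d) b≈ ⟩
      a + (12 + 12 * k) * d + i * d     ≡⟨ solve (a ∷ d ∷ i ∷ k ∷ []) ⟩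
      a + ((12 + 12 * k) + i) * d       ∎)
      where open ≈-Reasoning
    row-of : Dec (t < 12 + 12 * k) → ∃[ r₀ ] r₀ < h × cFirst a b d r₀ ≈ a + t * d
    row-of (yes t<) = t * 2 , even-row<h t< , ≡⇒≈ (cFirst-even a b d t)
    row-of (no t≮) = odd-row-of (split-< (≮⇒≥ t≮) (subst (t <_) halves t<h))

  f₂ f₃ : ℕ → ℕ
  f₂ = cFirst (5 + 6 * k) (11 + 12 * k) (12 + 12 * k)
  f₃ = cFirst (6 + 6 * k) (24 + 24 * k) (13 + 12 * k)

  -- On the first half c₂ = 1 + 2((2 + 3k) + t(6 + 6k)) along the index t of progression-row,
  -- and 4 inverts 6 + 6k modulo h.
  c₂-value : ∀ {t q r₀} (r₀<h : r₀ < h) → f₂ r₀ ≈ 5 + 6 * k + t * (12 + 12 * k) →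
             2 + 3 * k + t * (6 + 6 * k) Mod-h.≈ q → toℕ (c₂ k (row r₀ r₀<h)) ≈ 1 + (q + q)
  c₂-value {t} {q} {r₀} r₀<h f₂≈ x≈q = begin
    toℕ (c₂ k (row r₀ r₀<h))                      ≈⟨ cExt-row f₂ r₀<h ⟩
    f₂ r₀                                         ≈⟨ f₂≈ ⟩
    5 + 6 * k + t * (12 + 12 * k)                 ≡⟨ solve (k ∷ t ∷ []) ⟩
    1 + ((2 + 3 * k + t * (6 + 6 * k)) + (2 + 3 * k + t * (6 + 6 * k)))
                                                  ≈⟨ +-congˡ 1 (double-≈ (23 + 24 * k) x≈q) ⟩
    1 + (q + q)                                   ∎
    where open ≈-Reasoning

  c₂-odd : ∀ q → q < h → ∃[ r ] toℕ (c₂ k r) ≈ 1 + (q + q)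
  c₂-odd q q<h =
    let t , t<h , x≈q = Mod-h.affine-surjective {4} {6 + 6 * k} (Mod-h.≡+kN⇒≈ 1 (solve (k ∷ []))) (2 + 3 * k) q
        r₀ , r₀<h , f₂≈ = progression-row (5 + 6 * k) (11 + 12 * k) (12 + 12 * k)
                            (≈-sym (≡+kN⇒≈ (3 + 3 * k) (solve (k ∷ [])))) t t<h
    in row r₀ r₀<h , c₂-value {t} {q} r₀<h f₂≈ x≈q

  odd-pair≈0 : ∀ {q q′ c} → suc q + q′ ≡ h → c ≈ 1 + (q′ + q′) → 1 + (q + q) + c ≈ 0
  odd-pair≈0 {q} {q′} {c} q+q′≡h c≈ = begin
    1 + (q + q) + c                       ≈⟨ +-congˡ (1 + (q + q)) c≈ ⟩
    1 + (q + q) + (1 + (q′ + q′))         ≡⟨ solve (q ∷ q′ ∷ []) ⟩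
    (suc q + q′) + (suc q + q′)           ≡⟨ cong (λ m → m + m) q+q′≡h ⟩
    (23 + 24 * k) + (23 + 24 * k)         ≈⟨ N≈0 ⟩
    0                                     ∎
    where open ≈-Reasoning

  c₂-reaches : ∀ v → v < n → Reaches (c₂ k) v
  c₂-reaches v v<n = reach (even-or-odd v)
    where
    reach : ∃[ q ] (v ≡ q + q ⊎ v ≡ suc (q + q)) → Reaches (c₂ k) v
    reach (q , inj₂ refl) = let r , c₂≈ = c₂-odd q (half-< {q} (<-trans (n<1+n _) v<n)) in r , inj₁ c₂≈
    reach (q , inj₁ refl) =
      let q′ , q+q′≡h = m≤n⇒∃[o]m+o≡n (half-< {q} v<n)
          r , c₂≈ = c₂-odd q′ (subst (suc q′ ≤_) q+q′≡h (s≤s (m≤n+m q′ q)))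
      in r , inj₂ (odd-pair≈0 {q} {q′} q+q′≡h c₂≈)

  c₃-value : ∀ t → t < h → ∃[ r ] toℕ (c₃ k r) ≈ 6 + 6 * k + t * (13 + 12 * k)
  c₃-value t t<h =
    let r₀ , r₀<h , f₃≈ = progression-row (6 + 6 * k) (24 + 24 * k) (13 + 12 * k)
                            (≈-sym (≡+kN⇒≈ (3 + 3 * k) (solve (k ∷ [])))) t t<h
    in row r₀ r₀<h , ≈-trans (cExt-row f₃ r₀<h) f₃≈

  -- 2 (6 + 6k) + 1 = 13 + 12k is the common difference, so indices t and n - 1 - t give opposite values
  c₃-opposite : ∀ {v t t′ c} → 6 + 6 * k + t * (13 + 12 * k) ≈ v → suc t + t′ ≡ n →
                c ≈ 6 + 6 * k + t′ * (13 + 12 * k) → 1 + v + c ≈ 0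
  c₃-opposite {v} {t} {t′} {c} x≈v t+t′≡n c≈ = begin
    1 + v + c                                                        ≈⟨ +-congˡ (1 + v) c≈ ⟩
    1 + v + (6 + 6 * k + t′ * (13 + 12 * k))                         ≡⟨ +-assoc 1 v _ ⟩
    1 + (v + (6 + 6 * k + t′ * (13 + 12 * k)))                       ≈⟨ +-congˡ 1 (affine-reflect t t′ x≈v) ⟩
    1 + (6 + 6 * k + (6 + 6 * k) + (t + t′) * (13 + 12 * k))         ≡⟨ solve (k ∷ t ∷ t′ ∷ []) ⟩
    (13 + 12 * k) * (suc t + t′)                                     ≡⟨ cong ((13 + 12 * k) *_) t+t′≡n ⟩
    (13 + 12 * k) * ((23 + 24 * k) + (23 + 24 * k))                  ≈⟨ kN≈0 (13 + 12 * k) ⟩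
    0                                                                ∎
    where open ≈-Reasoning

  c₃-reaches : ∀ v → v < n → Reaches (c₃ k) v
  c₃-reaches v v<n =
    let t , t<n , x≈v = affine-surjective {39 + 40 * k} {13 + 12 * k} (≡+kN⇒≈ (11 + 10 * k) (solve (k ∷ []))) (6 + 6 * k) v
    in reach t t<n x≈v (t <? h)
    where
    reach : ∀ t → t < n → 6 + 6 * k + t * (13 + 12 * k) ≈ v → Dec (t < h) → Reaches (c₃ k) v
    reach t _ x≈v (yes t<h) = let r , c₃≈ = c₃-value t t<h in r , inj₁ (≈-trans c₃≈ x≈v)
    reach t t<n x≈v (no t≮h) =
      let t′ , t+t′≡n = m≤n⇒∃[o]m+o≡n t<n
          r , c₃≈ = c₃-value t′ (complement-< (s≤s (≮⇒≥ t≮h)) t+t′≡n)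
      in r , inj₂ (c₃-opposite {v} {t} {t′} x≈v t+t′≡n c₃≈)

  -- The difference c₂ - c₁ is 1 + 2((2 + 3k) + i(5 + 6k)) on row 2i and 2(i + 1)(5 + 6k) on row 2i + 1.

  inverse-5+6k : (14 + 16 * k) * (5 + 6 * k) Mod-h.≈ 1
  inverse-5+6k = Mod-h.≡+kN⇒≈ (3 + 4 * k) (solve (k ∷ []))

  c₁-row : ∀ {r₀} (r₀<h : r₀ < h) → toℕ (c₁ k (row r₀ r₀<h)) ≈ r₀
  c₁-row r₀<h = ≡⇒≈ (toℕ-row r₀<h)

  D₁₂-odd-direct : ∀ {q t} → 2 + 3 * k + t * (5 + 6 * k) Mod-h.≈ q → 1 + (q + q) + t * 2 ≈ f₂ (t * 2)
  D₁₂-odd-direct {q} {t} x≈q = begin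
    1 + (q + q) + t * 2                                                     ≈⟨ +-congʳ (t * 2) (+-congˡ 1 (double-≈ (23 + 24 * k) x≈q)) ⟨
    1 + ((2 + 3 * k + t * (5 + 6 * k)) + (2 + 3 * k + t * (5 + 6 * k))) + t * 2  ≡⟨ solve (k ∷ t ∷ []) ⟩
    5 + 6 * k + t * (12 + 12 * k)                                           ≡⟨ cFirst-even _ _ _ t ⟨
    f₂ (t * 2)                                                              ∎
    where open ≈-Reasoning

  D₁₂-odd-antipodal : ∀ {q t t′} → 2 + 3 * k + t * (5 + 6 * k) Mod-h.≈ q → suc t + t′ ≡ h →
                      1 + q + (2 + 3 * k + t′ * (5 + 6 * k)) Mod-h.≈ 0
  D₁₂-odd-antipodal {q} {t} {t′} x≈q t+t′≡h = begin
    1 + q + (2 + 3 * k + t′ * (5 + 6 * k))                    ≡⟨ +-assoc 1 q _ ⟩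
    1 + (q + (2 + 3 * k + t′ * (5 + 6 * k)))                  ≈⟨ Mod-h.+-congˡ 1 (Mod-h.affine-reflect t t′ x≈q) ⟩
    1 + (2 + 3 * k + (2 + 3 * k) + (t + t′) * (5 + 6 * k))    ≡⟨ solve (k ∷ t ∷ t′ ∷ []) ⟩
    (5 + 6 * k) * (suc t + t′)                                ≡⟨ cong ((5 + 6 * k) *_) t+t′≡h ⟩
    (5 + 6 * k) * (23 + 24 * k)                               ≈⟨ Mod-h.kN≈0 (5 + 6 * k) ⟩
    0                                                         ∎
    where open Mod-h.≈-Reasoning

  D₁₂-odd-opposite : ∀ {q t t′} → 2 + 3 * k + t * (5 + 6 * k) Mod-h.≈ q → suc t + t′ ≡ h →
                     1 + (q + q) + f₂ (t′ * 2) ≈ t′ * 2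
  D₁₂-odd-opposite {q} {t} {t′} x≈q t+t′≡h = begin
    1 + (q + q) + f₂ (t′ * 2)                                 ≡⟨ cong (1 + (q + q) +_) (cFirst-even _ _ _ t′) ⟩
    1 + (q + q) + (5 + 6 * k + t′ * (12 + 12 * k))            ≡⟨ solve (k ∷ q ∷ t′ ∷ []) ⟩
    (1 + q + (2 + 3 * k + t′ * (5 + 6 * k))) + (1 + q + (2 + 3 * k + t′ * (5 + 6 * k))) + t′ * 2
                                                              ≈⟨ +-congʳ (t′ * 2) (double-≈ (23 + 24 * k) (D₁₂-odd-antipodal {q} {t} {t′} x≈q t+t′≡h)) ⟩
    t′ * 2                                                    ∎
    where open ≈-Reasoning

  covers₁₂-odd : ∀ q → q < h → Covers (c₁ k) (c₂ k) (1 + (q + q))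
  covers₁₂-odd q q<h =
    let t , t<h , x≈q = Mod-h.affine-surjective {14 + 16 * k} {5 + 6 * k} inverse-5+6k (2 + 3 * k) q
    in cover t t<h x≈q (t <? 12 + 12 * k)
    where
    cover : ∀ t → t < h → 2 + 3 * k + t * (5 + 6 * k) Mod-h.≈ q → Dec (t < 12 + 12 * k) →
            Covers (c₁ k) (c₂ k) (1 + (q + q))
    cover t _ x≈q (yes t<) = let r₀<h = even-row<h t< in
      covers-row r₀<h (c₁-row r₀<h) (cExt-row f₂ r₀<h) (inj₁ (D₁₂-odd-direct {q} {t} x≈q))
    cover t t<h x≈q (no t≮) =
      let t′ , t+t′≡h = m≤n⇒∃[o]m+o≡n t<h
          r₀<h = even-row<h (<-trans (complement-< (s≤s (≮⇒≥ t≮)) (trans t+t′≡h h≡)) (n<1+n _))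
      in covers-row r₀<h (c₁-row r₀<h) (cExt-row f₂ r₀<h) (inj₂ (D₁₂-odd-opposite {q} {t} {t′} x≈q t+t′≡h))
      where
      h≡ : 23 + 24 * k ≡ (12 + 12 * k) + (11 + 12 * k)
      h≡ = solve (k ∷ [])

  D₁₂-even-direct : ∀ {q t} → 5 + 6 * k + t * (5 + 6 * k) Mod-h.≈ q → q + q + (1 + t * 2) ≈ f₂ (1 + t * 2)
  D₁₂-even-direct {q} {t} x≈q = begin
    q + q + (1 + t * 2)                                                       ≈⟨ +-congʳ (1 + t * 2) (double-≈ (23 + 24 * k) x≈q) ⟨
    (5 + 6 * k + t * (5 + 6 * k)) + (5 + 6 * k + t * (5 + 6 * k)) + (1 + t * 2)  ≡⟨ solve (k ∷ t ∷ []) ⟩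
    11 + 12 * k + t * (12 + 12 * k)                                           ≡⟨ cFirst-odd _ _ _ t ⟨
    f₂ (1 + t * 2)                                                            ∎
    where open ≈-Reasoning

  D₁₂-even-antipodal : ∀ {q t t′} → 5 + 6 * k + t * (5 + 6 * k) Mod-h.≈ q → suc t + t′ ≡ 22 + 24 * k →
                       q + (5 + 6 * k + t′ * (5 + 6 * k)) Mod-h.≈ 0
  D₁₂-even-antipodal {q} {t} {t′} x≈q t+t′≡ = begin
    q + (5 + 6 * k + t′ * (5 + 6 * k))                        ≈⟨ Mod-h.affine-reflect t t′ x≈q ⟩
    5 + 6 * k + (5 + 6 * k) + (t + t′) * (5 + 6 * k)          ≡⟨ solve (k ∷ t ∷ t′ ∷ []) ⟩
    (5 + 6 * k) * suc (suc t + t′)                            ≡⟨ cong (λ m → (5 + 6 * k) * suc m) t+t′≡ ⟩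
    (5 + 6 * k) * (23 + 24 * k)                               ≈⟨ Mod-h.kN≈0 (5 + 6 * k) ⟩
    0                                                         ∎
    where open Mod-h.≈-Reasoning

  D₁₂-even-opposite : ∀ {q t t′} → 5 + 6 * k + t * (5 + 6 * k) Mod-h.≈ q → suc t + t′ ≡ 22 + 24 * k →
                      q + q + f₂ (1 + t′ * 2) ≈ 1 + t′ * 2
  D₁₂-even-opposite {q} {t} {t′} x≈q t+t′≡ = begin
    q + q + f₂ (1 + t′ * 2)                                   ≡⟨ cong (q + q +_) (cFirst-odd _ _ _ t′) ⟩
    q + q + (11 + 12 * k + t′ * (12 + 12 * k))                ≡⟨ solve (k ∷ q ∷ t′ ∷ []) ⟩
    (q + (5 + 6 * k + t′ * (5 + 6 * k))) + (q + (5 + 6 * k + t′ * (5 + 6 * k))) + (1 + t′ * 2)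
                                                              ≈⟨ +-congʳ (1 + t′ * 2) (double-≈ (23 + 24 * k) (D₁₂-even-antipodal {q} {t} {t′} x≈q t+t′≡)) ⟩
    1 + t′ * 2                                                ∎
    where open ≈-Reasoning

  D₁₂-even-last : ∀ {q t} → q < h → t ≡ 22 + 24 * k → 5 + 6 * k + t * (5 + 6 * k) Mod-h.≈ q → q ≡ 0
  D₁₂-even-last {q} q<h refl x≈q = Mod-h.≈⇒≡ q<h z<s (begin
    q                                                  ≈⟨ x≈q ⟨
    5 + 6 * k + (22 + 24 * k) * (5 + 6 * k)            ≡⟨ solve (k ∷ []) ⟩
    (5 + 6 * k) * (23 + 24 * k)                        ≈⟨ Mod-h.kN≈0 (5 + 6 * k) ⟩
    0                                                  ∎)
    where open Mod-h.≈-Reasoning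

  covers₁₂-even : ∀ q → 0 < q → q < h → Covers (c₁ k) (c₂ k) (q + q)
  covers₁₂-even q 0<q q<h =
    let t , t<h , x≈q = Mod-h.affine-surjective {14 + 16 * k} {5 + 6 * k} inverse-5+6k (5 + 6 * k) q
    in cover t t<h x≈q (t <? 11 + 12 * k) (t <? 22 + 24 * k)
    where
    halves : 22 + 24 * k ≡ (11 + 12 * k) + (11 + 12 * k)
    halves = solve (k ∷ [])
    cover : ∀ t → t < h → 5 + 6 * k + t * (5 + 6 * k) Mod-h.≈ q →
            Dec (t < 11 + 12 * k) → Dec (t < 22 + 24 * k) → Covers (c₁ k) (c₂ k) (q + q)
    cover t _ x≈q (yes t<) _ = let r₀<h = odd-row<h t< in
      covers-row r₀<h (c₁-row r₀<h) (cExt-row f₂ r₀<h) (inj₁ (D₁₂-even-direct {q} {t} x≈q))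
    cover t _ x≈q (no t≮) (yes t<′) =
      let t′ , t+t′≡ = m≤n⇒∃[o]m+o≡n t<′
          r₀<h = odd-row<h (complement-< (s≤s (≮⇒≥ t≮)) (trans t+t′≡ halves))
      in covers-row r₀<h (c₁-row r₀<h) (cExt-row f₂ r₀<h) (inj₂ (D₁₂-even-opposite {q} {t} {t′} x≈q t+t′≡))
    cover t t<h x≈q (no _) (no t≮′) =
      contradiction (D₁₂-even-last {q} {t} q<h (≤-antisym (s≤s⁻¹ t<h) (≮⇒≥ t≮′)) x≈q) (n>0⇒n≢0 0<q)

  covers₁₂ : ∀ v → 0 < v → v < n → Covers (c₁ k) (c₂ k) v
  covers₁₂ v 0<v v<n = cover (even-or-odd v)
    where
    cover : ∃[ q ] (v ≡ q + q ⊎ v ≡ suc (q + q)) → Covers (c₁ k) (c₂ k) v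
    cover (q , inj₁ refl) = covers₁₂-even q (half-pos 0<v) (half-< {q} v<n)
    cover (q , inj₂ refl) = covers₁₂-odd q (half-< {q} (<-trans (n<1+n _) v<n))

  -- The difference c₃ - c₁ is 6 + 6k + i(11 + 12k) on row 2i and h + i(11 + 12k) on row 2i + 1.

  D₁₃-even-row : ∀ {t i} → (11 + 12 * k) + i ≡ t → (23 + 24 * k) + t * (11 + 12 * k) + i * 2 ≈ f₃ (i * 2)
  D₁₃-even-row {t} {i} refl = begin
    (23 + 24 * k) + ((11 + 12 * k) + i) * (11 + 12 * k) + i * 2   ≈⟨ ≡+kN⇒≈ (3 + 3 * k) (solve (k ∷ i ∷ [])) ⟩
    6 + 6 * k + i * (13 + 12 * k)                                 ≡⟨ cFirst-even _ _ _ i ⟨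
    f₃ (i * 2)                                                    ∎
    where open ≈-Reasoning

  D₁₃-odd-row : ∀ t → (23 + 24 * k) + t * (11 + 12 * k) + (1 + t * 2) ≈ f₃ (1 + t * 2)
  D₁₃-odd-row t = begin
    (23 + 24 * k) + t * (11 + 12 * k) + (1 + t * 2)   ≡⟨ solve (k ∷ t ∷ []) ⟩
    24 + 24 * k + t * (13 + 12 * k)                   ≡⟨ cFirst-odd _ _ _ t ⟨
    f₃ (1 + t * 2)                                    ∎
    where open ≈-Reasoning

  D₁₃-row : ∀ t → t < h → ∃[ r₀ ] r₀ < h × (23 + 24 * k) + t * (11 + 12 * k) + r₀ ≈ f₃ r₀
  D₁₃-row t t<h = row-of (t <? 11 + 12 * k)
    where
    row-of : Dec (t < 11 + 12 * k) → ∃[ r₀ ] r₀ < h × (23 + 24 * k) + t * (11 + 12 * k) + r₀ ≈ f₃ r₀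
    row-of (yes t<) = 1 + t * 2 , odd-row<h t< , D₁₃-odd-row t
    row-of (no t≮) =
      let i , i< , i+≡t = split-< (≮⇒≥ t≮) (subst (t <_) halves t<h)
      in i * 2 , even-row<h i< , D₁₃-even-row i+≡t
      where
      halves : 23 + 24 * k ≡ (11 + 12 * k) + (12 + 12 * k)
      halves = solve (k ∷ [])

  D₁₃-opposite : ∀ {v t t′ c r₀} → (23 + 24 * k) + t * (11 + 12 * k) ≈ v → t + t′ ≡ n →
                 (23 + 24 * k) + t′ * (11 + 12 * k) + r₀ ≈ c → v + c ≈ r₀
  D₁₃-opposite {v} {t} {t′} {c} {r₀} x≈v t+t′≡n x′+r₀≈c = begin
    v + c                                                                     ≈⟨ +-congˡ v x′+r₀≈c ⟨
    v + ((23 + 24 * k) + t′ * (11 + 12 * k) + r₀)                             ≡⟨ +-assoc v _ r₀ ⟨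
    v + ((23 + 24 * k) + t′ * (11 + 12 * k)) + r₀                             ≈⟨ +-congʳ r₀ (affine-reflect t t′ x≈v) ⟩
    (23 + 24 * k) + (23 + 24 * k) + (t + t′) * (11 + 12 * k) + r₀             ≡⟨ cong (λ m → (23 + 24 * k) + (23 + 24 * k) + m * (11 + 12 * k) + r₀) t+t′≡n ⟩
    (23 + 24 * k) + (23 + 24 * k) + ((23 + 24 * k) + (23 + 24 * k)) * (11 + 12 * k) + r₀
                                                                              ≈⟨ ≡+kN⇒≈ (12 + 12 * k) (solve (k ∷ r₀ ∷ [])) ⟩
    r₀                                                                        ∎
    where open ≈-Reasoning

  D₁₃-at-half : ∀ {v} → v < n → (23 + 24 * k) + (23 + 24 * k) * (11 + 12 * k) ≈ v → v ≡ 0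
  D₁₃-at-half v<n x≈v = ≈⇒≡ v<n z<s (≈-trans (≈-sym x≈v) (≡+kN⇒≈ (6 + 6 * k) (solve (k ∷ []))))

  covers₁₃ : ∀ v → 0 < v → v < n → Covers (c₁ k) (c₃ k) v
  covers₁₃ v 0<v v<n =
    let t , t<n , x≈v = affine-surjective {21 + 24 * k} {11 + 12 * k} (≡+kN⇒≈ (5 + 6 * k) (solve (k ∷ []))) (23 + 24 * k) v
    in cover t t<n x≈v (<-cmp t h)
    where
    cover : ∀ t → t < n → (23 + 24 * k) + t * (11 + 12 * k) ≈ v → Tri (t < h) (t ≡ h) (h < t) → Covers (c₁ k) (c₃ k) v
    cover t _ x≈v (tri< t<h _ _) =
      let r₀ , r₀<h , x+r₀≈ = D₁₃-row t t<h
      in covers-row r₀<h (c₁-row r₀<h) (cExt-row f₃ r₀<h) (inj₁ (≈-trans (+-congʳ r₀ (≈-sym x≈v)) x+r₀≈))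
    cover t _ x≈v (tri≈ _ refl _) = contradiction (D₁₃-at-half v<n x≈v) (n>0⇒n≢0 0<v)
    cover t t<n x≈v (tri> _ _ h<t) =
      let t′ , t+t′≡n = m≤n⇒∃[o]m+o≡n (<⇒≤ t<n)
          r₀ , r₀<h , x′+r₀≈ = D₁₃-row t′ (complement-< h<t t+t′≡n)
      in covers-row r₀<h (c₁-row r₀<h) (cExt-row f₃ r₀<h) (inj₂ (D₁₃-opposite {v} {t} {t′} x≈v t+t′≡n x′+r₀≈))

  -- The difference c₃ - c₂ is i + 1 on row 2i and 13 + 12k + i on row 2i + 1.

  D₂₃-odd-row : ∀ {s i} → (12 + 12 * k) + i ≡ s → suc s + f₂ (1 + i * 2) ≡ f₃ (1 + i * 2)
  D₂₃-odd-row {i = i} refl = begin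
    suc ((12 + 12 * k) + i) + f₂ (1 + i * 2)                      ≡⟨ cong (suc ((12 + 12 * k) + i) +_) (cFirst-odd _ _ _ i) ⟩
    suc ((12 + 12 * k) + i) + (11 + 12 * k + i * (12 + 12 * k))   ≡⟨ solve (k ∷ i ∷ []) ⟩
    24 + 24 * k + i * (13 + 12 * k)                               ≡⟨ cFirst-odd _ _ _ i ⟨
    f₃ (1 + i * 2)                                                ∎
    where open ≡-Reasoning

  D₂₃-even-row : ∀ s → suc s + f₂ (s * 2) ≡ f₃ (s * 2)
  D₂₃-even-row s = begin
    suc s + f₂ (s * 2)                          ≡⟨ cong (suc s +_) (cFirst-even _ _ _ s) ⟩
    suc s + (5 + 6 * k + s * (12 + 12 * k))     ≡⟨ solve (k ∷ s ∷ []) ⟩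
    6 + 6 * k + s * (13 + 12 * k)               ≡⟨ cFirst-even _ _ _ s ⟨
    f₃ (s * 2)                                  ∎
    where open ≡-Reasoning

  D₂₃-row : ∀ t → 0 < t → t ≤ h → ∃[ r₀ ] r₀ < h × t + f₂ r₀ ≡ f₃ r₀
  D₂₃-row (suc s) _ s<h = row-of (s <? 12 + 12 * k)
    where
    row-of : Dec (s < 12 + 12 * k) → ∃[ r₀ ] r₀ < h × suc s + f₂ r₀ ≡ f₃ r₀
    row-of (yes s<) = s * 2 , even-row<h s< , D₂₃-even-row s
    row-of (no s≮) =
      let i , i< , i+≡s = split-< (≮⇒≥ s≮) (subst (s <_) halves s<h)
      in 1 + i * 2 , odd-row<h i< , D₂₃-odd-row i+≡s
      where
      halves : 23 + 24 * k ≡ (12 + 12 * k) + (11 + 12 * k)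
      halves = solve (k ∷ [])

  D₂₃-opposite : ∀ {v w a b} → v + w ≡ n → w + a ≡ b → v + b ≈ a
  D₂₃-opposite {v} {w} {a} {b} v+w≡n w+a≡b = begin
    v + b          ≡⟨ cong (v +_) w+a≡b ⟨
    v + (w + a)    ≡⟨ +-assoc v w a ⟨
    v + w + a      ≡⟨ cong (_+ a) v+w≡n ⟩
    n + a          ≈⟨ +-congʳ a N≈0 ⟩
    a              ∎
    where open ≈-Reasoning

  covers₂₃ : ∀ v → 0 < v → v < n → Covers (c₂ k) (c₃ k) v
  covers₂₃ v 0<v v<n = cover (v ≤? h)
    where
    cover : Dec (v ≤ h) → Covers (c₂ k) (c₃ k) v
    cover (yes v≤h) =
      let r₀ , r₀<h , v+f₂≡f₃ = D₂₃-row v 0<v v≤h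
      in covers-row r₀<h (cExt-row f₂ r₀<h) (cExt-row f₃ r₀<h) (inj₁ (≡⇒≈ v+f₂≡f₃))
    cover (no v≰h) =
      let w , v+w≡n = m≤n⇒∃[o]m+o≡n (<⇒≤ v<n)
          0<w = n≢0⇒n>0 (λ w≡0 → <-irrefl (trans (sym (+-identityʳ v)) (subst (λ x → v + x ≡ n) w≡0 v+w≡n)) v<n)
          r₀ , r₀<h , w+f₂≡f₃ = D₂₃-row w 0<w (<⇒≤ (complement-< (≰⇒> v≰h) v+w≡n))
      in covers-row r₀<h (cExt-row f₂ r₀<h) (cExt-row f₃ r₀<h) (inj₂ (D₂₃-opposite v+w≡n w+f₂≡f₃))

  isLatin₁ : IsLatin (𝓛₁ k)
  isLatin₁ = isLatin-cyclic (c₁ k) (λ s → s , refl)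

  isLatin₂ : IsLatin (𝓛₂ k)
  isLatin₂ = isLatin-cyclic (c₂ k) (reaches⇒surjective (c₂ k) (cExt-commutes f₂) c₂-reaches)

  isLatin₃ : IsLatin (𝓛₃ k)
  isLatin₃ = isLatin-cyclic (c₃ k) (reaches⇒surjective (c₃ k) (cExt-commutes f₃) c₃-reaches)

  open NearOrthogonality (half k) using (nearlyOrthogonal-cyclic)

  nearlyOrthogonal₁₂ : NearlyOrthogonal (half k) (𝓛₁ k) (𝓛₂ k)
  nearlyOrthogonal₁₂ = nearlyOrthogonal-cyclic (c₁ k) (c₂ k) c₁-commutes (cExt-commutes f₂) covers₁₂

  nearlyOrthogonal₁₃ : NearlyOrthogonal (half k) (𝓛₁ k) (𝓛₃ k)
  nearlyOrthogonal₁₃ = nearlyOrthogonal-cyclic (c₁ k) (c₃ k) c₁-commutes (cExt-commutes f₃) covers₁₃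

  nearlyOrthogonal₂₃ : NearlyOrthogonal (half k) (𝓛₂ k) (𝓛₃ k)
  nearlyOrthogonal₂₃ = nearlyOrthogonal-cyclic (c₂ k) (c₃ k) (cExt-commutes f₂) (cExt-commutes f₃) covers₂₃

theorem6 : (k : ℕ) →
    IsLatin (𝓛₁ k) × IsLatin (𝓛₂ k) × IsLatin (𝓛₃ k) ×
    NearlyOrthogonal (half k) (𝓛₁ k) (𝓛₂ k) ×
    NearlyOrthogonal (half k) (𝓛₁ k) (𝓛₃ k) ×
    NearlyOrthogonal (half k) (𝓛₂ k) (𝓛₃ k)
theorem6 k = isLatin₁ , isLatin₂ , isLatin₃ , nearlyOrthogonal₁₂ , nearlyOrthogonal₁₃ , nearlyOrthogonal₂₃
  where open Construction k
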